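{- For zero-size items with at least three colors, there is no deterministic online algorithm for Colored Bin Packing with asymptotic competitive ratio less than $1.5$. Precisely, for every deterministic online algorithm and every integer $n>1$ there is a sequence of zero-size items using only three colors such that $\mathrm{OPT} = n$ and the algorithm uses at least $\lceil 1.5n\rceil$ bins on it.
   Context: Colored Bin Packing: items arrive as a sequence; each item has a size in $[0,1]$ and a color from a finite set $C$. A packing assigns every item to a bin of unit capacity; the items in a bin are ordered by their arrival. A packing is valid if in every bin the total size is at most $1$ and no two items that are consecutive in that bin have the same color. $\mathrm{OPT}(L)$ is the minimum number of bins in a valid packing of $L$ without reordering. An online algorithm receives items one by one, must irrevocably place each item into an existing bin (respecting validity) or a new bin before seeing the next item, and does not know future items. $\mathrm{ALG}(L)$ is the number of bins it uses. An algorithm is asymptotically $r$-competitive if $\mathrm{ALG}(L)\le r\cdot \mathrm{OPT}(L)+o(\mathrm{OPT}(L))$ for all $L$; its asymptotic competitive ratio is the infimum of such $r$. -}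

module Defs where

open import Data.Nat using (ℕ; zero; suc; _<_; _≡ᵇ_; _⊔_)
open import Data.Fin using (Fin; toℕ)
open import Data.Bool using (if_then_else_)
open import Data.Maybe using (Maybe; just; nothing)
open import Data.List using (List; []; _∷_; _++_)
open import Data.Product using (_×_; ∃)
open import Data.Sum using (_⊎_)
open import Data.Unit using (⊤)
open import Data.Empty using (⊥)
open import Relation.Binary.PropositionalEquality using (_≡_; _≢_)
open import Relation.Nullary using (¬_)

-- Zero-size items: an item is just its color; three colors.
Color : Set
Color = Fin 3

-- "last color seen in each bin" (nothing = empty bin), bins indexed by ℕ
LastColors : Set
LastColors = ℕ → Maybe Color

noBins : LastColors
noBins _ = nothing

put : LastColors → ℕ → Color → LastColors
put last b c j = if j ≡ᵇ b then just c else last j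

-- Sizes are zero, so only the color condition matters: an item may be
-- placed in a bin only if the previous item in that bin has a different
-- color.

ValidFrom : {k : ℕ} → LastColors → List Color → List (Fin k) → Set
ValidFrom last [] [] = ⊤
ValidFrom last [] (_ ∷ _) = ⊥
ValidFrom last (_ ∷ _) [] = ⊥
ValidFrom last (c ∷ cs) (b ∷ bs) =
  (last (toℕ b) ≢ just c) × ValidFrom (put last (toℕ b) c) cs bs

PackableIn : List Color → ℕ → Set
PackableIn L k = ∃ λ (σ : List (Fin k)) → ValidFrom noBins L σ

OPTis : List Color → ℕ → Set
OPTis L n = PackableIn L n × (∀ k → k < n → ¬ PackableIn L k)

-- Given the colors of all previously arrived items (in arrival order) and
-- the color of the current item, return the index of the bin for the
-- current item (index = current number of bins means: open a new bin).
-- Past decisions of a deterministic algorithm are a function of the past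
-- input, so this is fully general.

OnlineAlg : Set
OnlineAlg = List Color → Color → ℕ

record State : Set where
  constructor st
  field
    nbins : ℕ
    lastc : LastColors
    hist  : List Color
open State public

initState : State
initState = st 0 noBins []

Legal : OnlineAlg → State → Color → Set
Legal A s c =
  let b = A (hist s) c in
  (b < nbins s × lastc s b ≢ just c) ⊎ b ≡ nbins s

step : OnlineAlg → State → Color → State
step A s c =
  let b = A (hist s) c in
  st (nbins s ⊔ suc b) (put (lastc s) b c) (hist s ++ (c ∷ []))

runFrom : OnlineAlg → State → List Color → State
runFrom A s [] = s
runFrom A s (c ∷ cs) = runFrom A (step A s c) cs

LegalRun : OnlineAlg → State → List Color → Set
LegalRun A s [] = ⊤
LegalRun A s (c ∷ cs) = Legal A s c × LegalRun A (step A s c) cs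

ValidAlg : OnlineAlg → Set
ValidAlg A = ∀ (L : List Color) → LegalRun A initState L

ALG : OnlineAlg → List Color → ℕ
ALG A L = nbins (runFrom A initState L)

module Submission where

-- With zero-size items only colors matter: a packing is valid iff no item
-- is placed on a bin whose top item has the same color, so both the online and
-- the offline packing are described by the top colors of their bins.
--
-- A *position* is an input prefix with OPT = n together with
-- an offline packing into n bins all topped by one color p.  From a position the
-- adversary appends a sequence M and then n items of a color x such that M can
-- be packed offline leaving no bin topped by x ("flooding" with x); online, the
-- number of bins topped by x then grows by n.  A *round* alternates the two
-- colors other than p and floods as soon as the next color of the alternation
-- tops τ online bins; counting the three colors shows that some flood is
-- possible while 3τ ≤ ALG + 1.  Rounds with τ = 1, 2, …, ⌊n/2⌋ force n + ⌊n/2⌋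
-- online bins, which is ⌈3n/2⌉ for even n; for odd n a last round and a small
-- gadget force one more bin.

open import Defs
open import Function using (_∘_)
open import Data.Nat using (ℕ; zero; suc; _+_; _*_; _≤_; _<_; z≤n; s≤s; s≤s⁻¹; z<s; ⌈_/2⌉)
open import Data.Nat.Properties
open import Data.Nat.Tactic.RingSolver using (solve-∀)
open import Data.Fin using (Fin; toℕ; fromℕ<; zero; suc)
open import Data.Fin.Properties using (toℕ-fromℕ<; toℕ<n) renaming (_≟_ to _≟ᶜ_)
open import Data.Bool using (true; false; if_then_else_)
open import Data.Maybe using (Maybe; just; nothing)
open import Data.Maybe.Properties using (≡-dec; just-injective)
open import Data.List using (List; []; _∷_; _++_; replicate; length; applyUpTo)
open import Data.List.Properties using (++-assoc; applyUpTo-∷ʳ; length-applyUpTo; length-replicate)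
open import Data.List.Relation.Unary.All using (All; []; _∷_)
open import Data.List.Relation.Unary.All.Properties using (replicate⁺; applyUpTo⁺₂)
open import Data.List.Relation.Unary.Linked using (Linked; [-]; _∷_)
open import Data.Product using (Σ; ∃; _×_; _,_; proj₁)
open import Data.Sum using (_⊎_; inj₁; inj₂)
open import Data.Unit using (tt)
open import Data.Empty using (⊥; ⊥-elim)
open import Relation.Binary.PropositionalEquality
open import Relation.Nullary using (¬_; does; yes; no)
open import Relation.Nullary.Decidable using (dec-true; dec-false)

next prev : Color → Color
next zero = suc zero
next (suc zero) = suc (suc zero)
next (suc (suc zero)) = zero
prev zero = suc (suc zero)
prev (suc zero) = zero
prev (suc (suc zero)) = suc zero

p≢next : ∀ p → p ≢ next p
p≢next zero ()
p≢next (suc zero) ()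
p≢next (suc (suc zero)) ()

p≢prev : ∀ p → p ≢ prev p
p≢prev zero ()
p≢prev (suc zero) ()
p≢prev (suc (suc zero)) ()

next≢prev : ∀ p → next p ≢ prev p
next≢prev zero ()
next≢prev (suc zero) ()
next≢prev (suc (suc zero)) ()

data AllThree : Color → Color → Color → Set where
  forward  : ∀ p → AllThree p (next p) (prev p)
  backward : ∀ p → AllThree p (prev p) (next p)

module _ {p x y : Color} where

  first≢second : AllThree p x y → p ≢ x
  first≢second (forward p) = p≢next p
  first≢second (backward p) = p≢prev p

  first≢third : AllThree p x y → p ≢ y
  first≢third (forward p) = p≢prev p
  first≢third (backward p) = p≢next p

  second≢third : AllThree p x y → x ≢ y
  second≢third (forward p) = next≢prev p
  second≢third (backward p) = ≢-sym (next≢prev p)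

completeTriple : ∀ {p d} → d ≢ p → ∃ λ x → AllThree p x d
completeTriple {zero} {zero} d≢p = ⊥-elim (d≢p refl)
completeTriple {zero} {suc zero} _ = _ , backward zero
completeTriple {zero} {suc (suc zero)} _ = _ , forward zero
completeTriple {suc zero} {zero} _ = _ , forward (suc zero)
completeTriple {suc zero} {suc zero} d≢p = ⊥-elim (d≢p refl)
completeTriple {suc zero} {suc (suc zero)} _ = _ , backward (suc zero)
completeTriple {suc (suc zero)} {zero} _ = _ , backward (suc (suc zero))
completeTriple {suc (suc zero)} {suc zero} _ = _ , forward (suc (suc zero))
completeTriple {suc (suc zero)} {suc (suc zero)} d≢p = ⊥-elim (d≢p refl)

ends : Maybe Color → Color → ℕ
ends x c = if does (≡-dec _≟ᶜ_ x (just c)) then 1 else 0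

ends-same : ∀ c → ends (just c) c ≡ 1
ends-same c rewrite dec-true (≡-dec _≟ᶜ_ (just c) (just c)) refl = refl

ends-other : ∀ {x c} → x ≢ just c → ends x c ≡ 0
ends-other {x} {c} x≢c rewrite dec-false (≡-dec _≟ᶜ_ x (just c)) x≢c = refl

ends≤1 : ∀ x c → ends x c ≤ 1
ends≤1 x c with does (≡-dec _≟ᶜ_ x (just c))
... | true = ≤-refl
... | false = z≤n

ends-cycle : ∀ p d → ends (just d) p + ends (just d) (next p) + ends (just d) (prev p) ≡ 1
ends-cycle zero zero = refl
ends-cycle zero (suc zero) = refl
ends-cycle zero (suc (suc zero)) = refl
ends-cycle (suc zero) zero = refl
ends-cycle (suc zero) (suc zero) = refl
ends-cycle (suc zero) (suc (suc zero)) = refl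
ends-cycle (suc (suc zero)) zero = refl
ends-cycle (suc (suc zero)) (suc zero) = refl
ends-cycle (suc (suc zero)) (suc (suc zero)) = refl

ends-allThree : ∀ {p x y} → AllThree p x y → ∀ d → ends (just d) p + ends (just d) x + ends (just d) y ≡ 1
ends-allThree (forward p) d = ends-cycle p d
ends-allThree (backward p) d =
  trans (swap (ends (just d) p) (ends (just d) (prev p)) (ends (just d) (next p))) (ends-cycle p d)
  where
  swap : ∀ a b c → a + b + c ≡ a + c + b
  swap = solve-∀

put-same : ∀ l b c → put l b c b ≡ just c
put-same l b c rewrite dec-true (b ≟ b) refl = refl

put-other : ∀ l b c {j} → j ≢ b → put l b c j ≡ l j
put-other l b c {j} j≢b rewrite dec-false (j ≟ b) j≢b = refl

count : LastColors → ℕ → Color → ℕ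
count l zero d = 0
count l (suc N) d = ends (l N) d + count l N d

count≤ : ∀ l N d → count l N d ≤ N
count≤ l zero d = z≤n
count≤ l (suc N) d = +-mono-≤ (ends≤1 (l N) d) (count≤ l N d)

count-put-beyond : ∀ l b c N d → N ≤ b → count (put l b c) N d ≡ count l N d
count-put-beyond l b c zero d _ = refl
count-put-beyond l b c (suc N) d N<b =
  cong₂ _+_ (cong (λ x → ends x d) (put-other l b c (<⇒≢ N<b)))
            (count-put-beyond l b c N d (<⇒≤ N<b))

count-put : ∀ l b c N d → b < N →
            count (put l b c) N d + ends (l b) d ≡ count l N d + ends (just c) d
count-put l b c (suc N) d b<1+N with m≤n⇒m<n∨m≡n (s≤s⁻¹ b<1+N)
... | inj₂ refl = begin
  ends (put l b c b) d + count (put l b c) b d + ends (l b) d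
    ≡⟨ cong₂ (λ x y → ends x d + y + ends (l b) d) (put-same l b c) (count-put-beyond l b c b d ≤-refl) ⟩
  ends (just c) d + count l b d + ends (l b) d
    ≡⟨ swap-outer (ends (just c) d) (count l b d) (ends (l b) d) ⟩
  ends (l b) d + count l b d + ends (just c) d ∎
  where
  open ≡-Reasoning
  swap-outer : ∀ x y z → x + y + z ≡ z + y + x
  swap-outer = solve-∀
... | inj₁ b<N = begin
  ends (put l b c N) d + count (put l b c) N d + ends (l b) d
    ≡⟨ cong (λ x → ends x d + count (put l b c) N d + ends (l b) d) (put-other l b c (≢-sym (<⇒≢ b<N))) ⟩
  ends (l N) d + count (put l b c) N d + ends (l b) d
    ≡⟨ +-assoc (ends (l N) d) _ _ ⟩
  ends (l N) d + (count (put l b c) N d + ends (l b) d)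
    ≡⟨ cong (ends (l N) d +_) (count-put l b c N d b<N) ⟩
  ends (l N) d + (count l N d + ends (just c) d)
    ≡⟨ +-assoc (ends (l N) d) _ _ ⟨
  ends (l N) d + count l N d + ends (just c) d ∎
  where open ≡-Reasoning

count-put-fresh : ∀ l b c N → b < N → l b ≢ just c → count (put l b c) N c ≡ suc (count l N c)
count-put-fresh l b c N b<N free = begin
  count (put l b c) N c                ≡⟨ +-identityʳ _ ⟨
  count (put l b c) N c + 0            ≡⟨ cong (count (put l b c) N c +_) (ends-other free) ⟨
  count (put l b c) N c + ends (l b) c ≡⟨ count-put l b c N c b<N ⟩
  count l N c + ends (just c) c        ≡⟨ cong (count l N c +_) (ends-same c) ⟩
  count l N c + 1                      ≡⟨ +-comm _ 1 ⟩
  suc (count l N c)                    ∎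
  where open ≡-Reasoning

count-put-cover : ∀ l b c N d → b < N → l b ≡ just d → d ≢ c → suc (count (put l b c) N d) ≡ count l N d
count-put-cover l b c N d b<N top≡d d≢c = begin
  suc (count (put l b c) N d)          ≡⟨ +-comm 1 _ ⟩
  count (put l b c) N d + 1            ≡⟨ cong (count (put l b c) N d +_) (ends-same d) ⟨
  count (put l b c) N d + ends (just d) d ≡⟨ cong (λ x → count (put l b c) N d + ends x d) top≡d ⟨
  count (put l b c) N d + ends (l b) d ≡⟨ count-put l b c N d b<N ⟩
  count l N d + ends (just c) d        ≡⟨ cong (count l N d +_) (ends-other (d≢c ∘ sym ∘ just-injective)) ⟩
  count l N d + 0                      ≡⟨ +-identityʳ _ ⟩
  count l N d                          ∎
  where open ≡-Reasoning

count-allThree : ∀ {p x y} → AllThree p x y → ∀ l N → (∀ j → j < N → l j ≢ nothing) →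
                 count l N p + count l N x + count l N y ≡ N
count-allThree t l zero _ = refl
count-allThree {p} {x} {y} t l (suc N) nonempty with l N | nonempty N ≤-refl
... | nothing | l-N≢nothing = ⊥-elim (l-N≢nothing refl)
... | just d | _ = begin
  (ends (just d) p + count l N p) + (ends (just d) x + count l N x) + (ends (just d) y + count l N y)
    ≡⟨ regroup (ends (just d) p) (ends (just d) x) (ends (just d) y) (count l N p) (count l N x) (count l N y) ⟩
  (ends (just d) p + ends (just d) x + ends (just d) y) + (count l N p + count l N x + count l N y)
    ≡⟨ cong₂ _+_ (ends-allThree t d) (count-allThree t l N (λ j j<N → nonempty j (m≤n⇒m≤1+n j<N))) ⟩
  suc N ∎
  where
  open ≡-Reasoning
  regroup : ∀ a b c u v w → (a + u) + (b + v) + (c + w) ≡ (a + b + c) + (u + v + w)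
  regroup = solve-∀

occurrences : Color → List Color → ℕ
occurrences d [] = 0
occurrences d (c ∷ M) = ends (just c) d + occurrences d M

module Online (A : OnlineAlg) (valid : ValidAlg A) where

  chosen : State → Color → ℕ
  chosen s c = A (hist s) c

  topsOf : State → Color → ℕ
  topsOf s d = count (lastc s) (nbins s) d

  Nonempty : State → Set
  Nonempty s = ∀ j → j < nbins s → lastc s j ≢ nothing

  step-bins-mono : ∀ s c → nbins s ≤ nbins (step A s c)
  step-bins-mono s c = m≤m⊔n (nbins s) _

  step-bins-old : ∀ s c → chosen s c < nbins s → nbins (step A s c) ≡ nbins s
  step-bins-old s c b<N = m≥n⇒m⊔n≡m b<N

  step-bins-new : ∀ s c → chosen s c ≡ nbins s → nbins (step A s c) ≡ suc (nbins s)
  step-bins-new s c b≡N rewrite b≡N = m≤n⇒m⊔n≡n (n≤1+n (nbins s))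

  step-tops-old : ∀ s c d → chosen s c < nbins s →
    topsOf (step A s c) d + ends (lastc s (chosen s c)) d ≡ topsOf s d + ends (just c) d
  step-tops-old s c d b<N rewrite step-bins-old s c b<N =
    count-put (lastc s) (chosen s c) c (nbins s) d b<N

  step-tops-new : ∀ s c d → chosen s c ≡ nbins s →
    topsOf (step A s c) d ≡ ends (just c) d + topsOf s d
  step-tops-new s c d b≡N rewrite step-bins-new s c b≡N | b≡N | put-same (lastc s) (nbins s) c
    | count-put-beyond (lastc s) (nbins s) c (nbins s) d ≤-refl = refl

  step-tops-same : ∀ s c → Legal A s c → topsOf (step A s c) c ≡ suc (topsOf s c)
  step-tops-same s c (inj₁ (b<N , free)) rewrite step-bins-old s c b<N =
    count-put-fresh (lastc s) (chosen s c) c (nbins s) b<N free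
  step-tops-same s c (inj₂ b≡N) = trans (step-tops-new s c c b≡N) (cong (_+ topsOf s c) (ends-same c))

  step-tops-bound : ∀ s c d → Legal A s c → topsOf (step A s c) d ≤ topsOf s d + ends (just c) d
  step-tops-bound s c d (inj₁ (b<N , _)) = ≤-trans (m≤m+n _ _) (≤-reflexive (step-tops-old s c d b<N))
  step-tops-bound s c d (inj₂ b≡N) =
    ≤-reflexive (trans (step-tops-new s c d b≡N) (+-comm (ends (just c) d) (topsOf s d)))

  step-tops-cover : ∀ s c d → chosen s c < nbins s → lastc s (chosen s c) ≡ just d → d ≢ c →
                    suc (topsOf (step A s c) d) ≡ topsOf s d
  step-tops-cover s c d b<N top≡d d≢c rewrite step-bins-old s c b<N =
    count-put-cover (lastc s) (chosen s c) c (nbins s) d b<N top≡d d≢c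

  step-nonempty : ∀ s c → Legal A s c → Nonempty s → Nonempty (step A s c)
  step-nonempty s c legal nonempty j j<N′ with j ≟ chosen s c
  ... | yes refl rewrite put-same (lastc s) j c = λ ()
  ... | no j≢b rewrite put-other (lastc s) (chosen s c) c j≢b = nonempty j (old-bin legal)
    where
    old-bin : Legal A s c → j < nbins s
    old-bin (inj₁ (b<N , _)) = subst (j <_) (step-bins-old s c b<N) j<N′
    old-bin (inj₂ b≡N) = ≤∧≢⇒< (s≤s⁻¹ (subst (j <_) (step-bins-new s c b≡N) j<N′))
                              (λ j≡N → j≢b (trans j≡N (sym b≡N)))

  run-++ : ∀ s xs ys → runFrom A s (xs ++ ys) ≡ runFrom A (runFrom A s xs) ys
  run-++ s [] ys = refl
  run-++ s (x ∷ xs) ys = run-++ (step A s x) xs ys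

  legal-suffix : ∀ s xs ys → LegalRun A s (xs ++ ys) → LegalRun A (runFrom A s xs) ys
  legal-suffix s [] ys legal = legal
  legal-suffix s (x ∷ xs) ys (_ , legal) = legal-suffix (step A s x) xs ys legal

  run-bins-mono : ∀ s M → nbins s ≤ nbins (runFrom A s M)
  run-bins-mono s [] = ≤-refl
  run-bins-mono s (c ∷ M) = ≤-trans (step-bins-mono s c) (run-bins-mono (step A s c) M)

  run-nonempty : ∀ s M → LegalRun A s M → Nonempty s → Nonempty (runFrom A s M)
  run-nonempty s [] _ nonempty = nonempty
  run-nonempty s (c ∷ M) (legal , legals) nonempty =
    run-nonempty (step A s c) M legals (step-nonempty s c legal nonempty)

  run-tops-replicate : ∀ s k x → LegalRun A s (replicate k x) →
                       topsOf (runFrom A s (replicate k x)) x ≡ topsOf s x + k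
  run-tops-replicate s zero x _ = sym (+-identityʳ _)
  run-tops-replicate s (suc k) x (legal , legals) = begin
    topsOf (runFrom A (step A s x) (replicate k x)) x  ≡⟨ run-tops-replicate (step A s x) k x legals ⟩
    topsOf (step A s x) x + k                          ≡⟨ cong (_+ k) (step-tops-same s x legal) ⟩
    suc (topsOf s x) + k                               ≡⟨ +-suc (topsOf s x) k ⟨
    topsOf s x + suc k                                 ∎
    where open ≡-Reasoning

  run-tops-bound : ∀ s M d → LegalRun A s M → topsOf (runFrom A s M) d ≤ topsOf s d + occurrences d M
  run-tops-bound s [] d _ = m≤m+n _ _
  run-tops-bound s (c ∷ M) d (legal , legals) = begin
    topsOf (runFrom A (step A s c) M) d              ≤⟨ run-tops-bound (step A s c) M d legals ⟩
    topsOf (step A s c) d + occurrences d M          ≤⟨ +-monoˡ-≤ (occurrences d M) (step-tops-bound s c d legal) ⟩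
    topsOf s d + ends (just c) d + occurrences d M   ≡⟨ +-assoc (topsOf s d) _ _ ⟩
    topsOf s d + occurrences d (c ∷ M)               ∎
    where open ≤-Reasoning

  state : List Color → State
  state H = runFrom A initState H

  bins : List Color → ℕ
  bins H = nbins (state H)

  tops : List Color → Color → ℕ
  tops H d = topsOf (state H) d

  state-++ : ∀ H M → state (H ++ M) ≡ runFrom A (state H) M
  state-++ = run-++ initState

  legal-after : ∀ H M → LegalRun A (state H) M
  legal-after H M = legal-suffix initState H M (valid (H ++ M))

  nonempty : ∀ H → Nonempty (state H)
  nonempty H = run-nonempty initState H (valid H) (λ _ ())

  bins-mono : ∀ H M → bins H ≤ bins (H ++ M)
  bins-mono H M = subst (λ s → bins H ≤ nbins s) (sym (state-++ H M)) (run-bins-mono (state H) M)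

  tops≤bins : ∀ H d → tops H d ≤ bins H
  tops≤bins H d = count≤ (lastc (state H)) (bins H) d

  tops-replicate : ∀ H k x → tops (H ++ replicate k x) x ≡ tops H x + k
  tops-replicate H k x = trans (cong (λ s → topsOf s x) (state-++ H (replicate k x)))
                               (run-tops-replicate (state H) k x (legal-after H (replicate k x)))

  tops-bound : ∀ H M d → tops (H ++ M) d ≤ tops H d + occurrences d M
  tops-bound H M d = subst (λ s → topsOf s d ≤ tops H d + occurrences d M) (sym (state-++ H M))
                           (run-tops-bound (state H) M d (legal-after H M))

  tops-allThree : ∀ {p x y} → AllThree p x y → ∀ H → tops H p + tops H x + tops H y ≡ bins H
  tops-allThree t H = count-allThree t (lastc (state H)) (bins H) (nonempty H)

  state-snoc : ∀ H c → state (H ++ c ∷ []) ≡ step A (state H) c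
  state-snoc H c = state-++ H (c ∷ [])

  bins-new : ∀ H c → chosen (state H) c ≡ bins H → bins (H ++ c ∷ []) ≡ suc (bins H)
  bins-new H c b≡N rewrite state-snoc H c = step-bins-new (state H) c b≡N

  tops-cover : ∀ H c d → chosen (state H) c < bins H → lastc (state H) (chosen (state H) c) ≡ just d →
               d ≢ c → suc (tops (H ++ c ∷ []) d) ≡ tops H d
  tops-cover H c d b<N top≡d d≢c rewrite state-snoc H c = step-tops-cover (state H) c d b<N top≡d d≢c

top : Color → List Color → Color
top c [] = c
top c (d ∷ ds) = top d ds

module Offline (n : ℕ) where

  AllEnd : Color → LastColors → Set
  AllEnd x l = ∀ j → j < n → l j ≡ just x

  EndsIn : (Color → Set) → LastColors → Set
  EndsIn P l = ∀ j → j < n → ∃ λ c → l j ≡ just c × P c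

  avoids : ∀ {x l} → EndsIn (_≢ x) l → ∀ j → j < n → l j ≢ just x
  avoids ends j j<n l-j≡x with ends j j<n
  ... | c , l-j≡c , c≢x = c≢x (just-injective (trans (sym l-j≡c) l-j≡x))

  data Packing (Q : LastColors → Set) : LastColors → List Color → Set where
    done  : ∀ {l} → Q l → Packing Q l []
    place : ∀ {l c M} b → b < n → l b ≢ just c → Packing Q (put l b c) M → Packing Q l (c ∷ M)

  packing-valid : ∀ {Q l M} → Packing Q l M → ∃ λ (σ : List (Fin n)) → ValidFrom l M σ
  packing-valid (done _) = [] , tt
  packing-valid (place {l} {c} {M} b b<n free rest) with packing-valid rest
  ... | σ , valid = fromℕ< b<n ∷ σ ,
    subst (λ b′ → l b′ ≢ just c × ValidFrom (put l b′ c) M σ) (sym (toℕ-fromℕ< b<n)) (free , valid)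

  infixl 4 _then_
  _then_ : ∀ {Q₁ Q l M M′} → Packing Q₁ l M → (∀ {l′} → Q₁ l′ → Packing Q l′ M′) →
           Packing Q l (M ++ M′)
  done q then continue = continue q
  place b b<n free rest then continue = place b b<n free (rest then continue)

  weaken : ∀ {Q₁ Q₂ l M} → (∀ {l′} → Q₁ l′ → Q₂ l′) → Packing Q₁ l M → Packing Q₂ l M
  weaken f (done q) = done (f q)
  weaken f (place b b<n free rest) = place b b<n free (weaken f rest)

  spread : ∀ (P : Color → Set) k M l → k + length M ≡ n → All P M →
           (∀ j → j < k → ∃ λ c → l j ≡ just c × P c) →
           (∀ j c → k ≤ j → j < n → P c → l j ≢ just c) →
           Packing (EndsIn P) l M
  spread P k [] l size _ below _ =
    done (λ j j<n → below j (subst (j <_) (trans (sym size) (+-identityʳ k)) j<n))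
  spread P k (c ∷ M) l size (pc ∷ pM) below free =
    place k k<n (free k c ≤-refl k<n pc) (spread P (suc k) M (put l k c) size′ pM below′ free′)
    where
    size′ : suc k + length M ≡ n
    size′ = trans (sym (+-suc k (length M))) size
    k<n : k < n
    k<n = subst (k <_) size (m<m+n k z<s)
    below′ : ∀ j → j < suc k → ∃ λ c′ → put l k c j ≡ just c′ × P c′
    below′ j j<1+k with m≤n⇒m<n∨m≡n (s≤s⁻¹ j<1+k)
    ... | inj₁ j<k with below j j<k
    ...   | c′ , l-j≡c′ , pc′ = c′ , trans (put-other l k c (<⇒≢ j<k)) l-j≡c′ , pc′
    below′ j j<1+k | inj₂ refl = c , put-same l j c , pc
    free′ : ∀ j c′ → suc k ≤ j → j < n → P c′ → put l k c j ≢ just c′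
    free′ j c′ k<j j<n pc′ rewrite put-other l k c (≢-sym (<⇒≢ k<j)) = free j c′ (<⇒≤ k<j) j<n pc′

  fill : ∀ x l → (∀ j → j < n → l j ≢ just x) → Packing (AllEnd x) l (replicate n x)
  fill x l free =
    weaken all-x (spread (_≡ x) 0 (replicate n x) l (length-replicate n) (replicate⁺ n refl) (λ _ ())
                         (λ { j c _ j<n refl → free j j<n }))
    where
    all-x : ∀ {l′} → EndsIn (_≡ x) l′ → AllEnd x l′
    all-x ends j j<n with ends j j<n
    ... | c , l′-j≡c , refl = l′-j≡c

  stack : ∀ b → b < n → ∀ c xs l → Linked _≢_ (c ∷ xs) → l b ≡ just c →
          Packing (λ l′ → l′ b ≡ just (top c xs) × (∀ j → j ≢ b → l′ j ≡ l j)) l xs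
  stack b b<n c [] l _ at = done (at , λ _ _ → refl)
  stack b b<n c (d ∷ ds) l (c≢d ∷ linked) at =
    place b b<n (λ e → c≢d (just-injective (trans (sym at) e)))
      (weaken (λ { (at′ , others) → at′ , λ j j≢b → trans (others j j≢b) (put-other l b d j≢b) })
              (stack b b<n d ds (put l b d) linked (put-same l b d)))

  Strategy : Color → List Color → Color → Set
  Strategy p M x = ∀ {l} → AllEnd p l → Packing (AllEnd x) l M

  stack-then-fill : ∀ {p x} M → 0 < n → Linked _≢_ (p ∷ M) → top p M ≢ x → p ≢ x →
                    Strategy p (M ++ replicate n x) x
  stack-then-fill {p} {x} M 0<n linked top≢x p≢x {l} all-p =
    stack 0 0<n p M l linked (all-p 0 0<n) then λ { {l′} (at0 , others) → fill x l′ (free at0 others) }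
    where
    free : ∀ {l′ : LastColors} → l′ 0 ≡ just (top p M) → (∀ j → j ≢ 0 → l′ j ≡ l j) →
           ∀ j → j < n → l′ j ≢ just x
    free at0 others j j<n with j ≟ 0
    ... | yes refl = λ e → top≢x (just-injective (trans (sym at0) e))
    ... | no j≢0 = λ e → p≢x (just-injective (trans (sym (all-p j j<n)) (trans (sym (others j j≢0)) e)))

  spread-then-fill : ∀ {p} M → length M ≡ n → All (_≢ p) M → Strategy p (M ++ replicate n p) p
  spread-then-fill {p} M size fresh {l} all-p =
    spread (_≢ p) 0 M l size fresh (λ _ ())
           (λ j c _ j<n c≢p e → c≢p (just-injective (trans (sym e) (all-p j j<n))))
    then λ {l′} ends → fill p l′ (avoids ends)

-- j consecutive items of color c need j different bins not yet topped by c.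
-- In particular n items of one color cannot be packed into fewer than n bins.
replicate-needs : ∀ {k} l c j (σ : List (Fin k)) → ValidFrom l (replicate j c) σ → count l k c + j ≤ k
replicate-needs {k} l c zero σ _ = subst (_≤ k) (sym (+-identityʳ _)) (count≤ l k c)
replicate-needs {k} l c (suc j) (b ∷ σ) (free , valid) = begin
  count l k c + suc j              ≡⟨ +-suc _ j ⟩
  suc (count l k c) + j            ≡⟨ cong (_+ j) (count-put-fresh l (toℕ b) c k (toℕ<n b) free) ⟨
  count (put l (toℕ b) c) k c + j  ≤⟨ replicate-needs (put l (toℕ b) c) c j σ valid ⟩
  k                                ∎
  where open ≤-Reasoning

-- A packing of H ++ M restricts to a packing of H, so OPT(H) ≤ OPT(H ++ M).
prefix-valid : ∀ {k} l H M (σ : List (Fin k)) → ValidFrom l (H ++ M) σ →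
               ∃ λ (σ′ : List (Fin k)) → ValidFrom l H σ′
prefix-valid l [] M σ _ = [] , tt
prefix-valid l (c ∷ H) M (b ∷ σ) (free , valid) with prefix-valid (put l (toℕ b) c) H M σ valid
... | σ′ , valid′ = b ∷ σ′ , free , valid′

three-below : ∀ {a b c τ N} → a < τ → b ≤ τ → c < τ → 3 * τ ≤ suc N → a + b + c ≡ N → ⊥
three-below {a} {b} {c} {τ} {N} a<τ b≤τ c<τ room sum = 1+n≰n (begin
  suc (suc (a + b + c))  ≡⟨ shift a b c ⟩
  suc a + b + suc c      ≤⟨ +-mono-≤ (+-mono-≤ a<τ b≤τ) c<τ ⟩
  τ + τ + τ              ≡⟨ triple τ ⟩
  3 * τ                  ≤⟨ room ⟩
  suc N                  ≡⟨ cong suc sum ⟨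
  suc (a + b + c)        ∎)
  where
  open ≤-Reasoning
  shift : ∀ a b c → 2 + (a + b + c) ≡ (1 + a) + b + (1 + c)
  shift = solve-∀
  triple : ∀ τ → τ + τ + τ ≡ 3 * τ
  triple = solve-∀

middle-large : ∀ {a b c m N} → a + b + c ≡ N → a ≤ m → c ≤ m → suc (m + m) + m ≤ N → suc m ≤ b
middle-large {a} {b} {c} {m} {N} sum a≤m c≤m large with suc m ≤? b
... | yes enough = enough
... | no small = ⊥-elim (1+n≰n (begin
  suc (m + m) + m  ≤⟨ large ⟩
  N                ≡⟨ sum ⟨
  a + b + c        ≤⟨ +-mono-≤ (+-mono-≤ a≤m (s≤s⁻¹ (≰⇒> small))) c≤m ⟩
  m + m + m        ∎))
  where open ≤-Reasoning

last-zero : ∀ {a b c} → a + b + c ≡ a → c ≡ 0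
last-zero {a} {b} {c} sum = m+n≡0⇒n≡0 b (+-cancelˡ-≡ a (b + c) 0 (begin
  a + (b + c)  ≡⟨ +-assoc a b c ⟨
  a + b + c    ≡⟨ sum ⟩
  a            ≡⟨ +-identityʳ a ⟨
  a + 0        ∎))
  where open ≡-Reasoning

-- With 2(E+1) ≤ n and n + E bins, a round with threshold τ = E + 1 is allowed.
room-for-round : ∀ {E n N} → suc E + suc E ≤ n → n + E ≤ N → 3 * suc E ≤ suc N
room-for-round {E} {n} {N} small grown = begin
  3 * suc E                    ≡⟨ regroup E ⟩
  suc ((suc E + suc E) + E)    ≤⟨ s≤s (+-monoˡ-≤ E small) ⟩
  suc (n + E)                  ≤⟨ s≤s grown ⟩
  suc N                        ∎
  where
  open ≤-Reasoning
  regroup : ∀ E → 3 * (1 + E) ≡ 1 + (((1 + E) + (1 + E)) + E)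
  regroup = solve-∀

parity : ∀ n → ∃ λ h → n ≡ h + h ⊎ n ≡ suc (h + h)
parity zero = 0 , inj₁ refl
parity (suc n) with parity n
... | h , inj₁ even = h , inj₂ (cong suc even)
... | h , inj₂ odd = suc h , inj₁ (cong suc (trans odd (sym (+-suc h h))))

-- The bin counts reached at the end are at least ⌈3n/2⌉ (stated as 3n ≤ 2t).
even-target : ∀ {n} h → n ≡ h + h → 3 * n ≤ (n + h) + (n + h)
even-target h refl = ≤-reflexive (regroup h)
  where
  regroup : ∀ h → 3 * (h + h) ≡ (h + h + h) + (h + h + h)
  regroup = solve-∀

odd-target : ∀ {n} m → n ≡ suc (m + m) → 3 * n ≤ suc (n + m) + suc (n + m)
odd-target m refl = ≤-trans (n≤1+n _) (≤-reflexive (regroup m))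
  where
  regroup : ∀ m → 1 + 3 * (1 + (m + m)) ≡ (1 + ((1 + (m + m)) + m)) + (1 + ((1 + (m + m)) + m))
  regroup = solve-∀

-- For n = 2m + 1 and n + m bins, a round with threshold m is allowed.
odd-room : ∀ {n} m → n ≡ suc (m + m) → 3 * m ≤ suc (n + m)
odd-room m refl = ≤-trans (n≤1+n _) (≤-trans (n≤1+n _) (≤-reflexive (regroup m)))
  where
  regroup : ∀ m → 2 + 3 * m ≡ 1 + ((1 + (m + m)) + m)
  regroup = solve-∀

linked-applyUpTo : ∀ {c} (f : ℕ → Color) k → (∀ i → f i ≢ f (suc i)) → c ≢ f 0 →
                   Linked _≢_ (c ∷ applyUpTo f k)
linked-applyUpTo f zero _ _ = [-]
linked-applyUpTo f (suc k) alternates c≢f0 =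
  c≢f0 ∷ linked-applyUpTo (f ∘ suc) k (alternates ∘ suc) (alternates 0)

top-snoc : ∀ c xs y → top c (xs ++ y ∷ []) ≡ y
top-snoc c [] y = refl
top-snoc c (x ∷ xs) y = top-snoc x xs y

pairs : Color → Color → ℕ → List Color
pairs s o zero = []
pairs s o (suc k) = s ∷ o ∷ pairs s o k

module _ {s o : Color} (s≢o : s ≢ o) where

  length-pairs : ∀ k → length (pairs s o k) ≡ k + k
  length-pairs zero = refl
  length-pairs (suc k) = cong suc (trans (cong suc (length-pairs k)) (sym (+-suc k k)))

  pairs-linked : ∀ k → Linked _≢_ (o ∷ pairs s o k)
  pairs-linked zero = [-]
  pairs-linked (suc k) = ≢-sym s≢o ∷ s≢o ∷ pairs-linked k

  top-pairs : ∀ k → top o (pairs s o k) ≡ o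
  top-pairs zero = refl
  top-pairs (suc k) = top-pairs k

  occurrences-pairs : ∀ k → occurrences o (pairs s o k) ≡ k
  occurrences-pairs zero = refl
  occurrences-pairs (suc k) rewrite ends-other {just s} {o} (s≢o ∘ just-injective) | ends-same o =
    cong suc (occurrences-pairs k)

pairs-avoid : ∀ {s o p} → s ≢ p → o ≢ p → ∀ k → All (_≢ p) (pairs s o k)
pairs-avoid s≢p o≢p zero = []
pairs-avoid s≢p o≢p (suc k) = s≢p ∷ o≢p ∷ pairs-avoid s≢p o≢p k

occurrences-others : ∀ {p s o} → AllThree p s o → occurrences o (next p ∷ prev p ∷ []) ≡ 1
occurrences-others (forward p) rewrite ends-other {just (next p)} {prev p} (next≢prev p ∘ just-injective)
  | ends-same (prev p) = refl
occurrences-others (backward p) rewrite ends-same (next p)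
  | ends-other {just (prev p)} {next p} (≢-sym (next≢prev p) ∘ just-injective) = refl

module Adversary (A : OnlineAlg) (valid : ValidAlg A) (n : ℕ) (1<n : 1 < n) where
  open Online A valid
  open Offline n

  0<n : 0 < n
  0<n = <-trans z<s 1<n

  record Position (p : Color) : Set where
    field
      history : List Color
      offline : Packing (AllEnd p) noBins history
      needs-n : ∀ k → k < n → ¬ PackableIn history k
  open Position

  start : Position zero
  start = record
    { history = replicate n zero
    ; offline = fill zero noBins (λ _ _ ())
    ; needs-n = λ { k k<n (σ , v) → <⇒≱ k<n (≤-trans (m≤n+m n _) (replicate-needs noBins zero n σ v)) }
    }

  -- online, the n initial items of color 0 go to n different bins
  start-bins : n ≤ bins (history start)
  start-bins = ≤-trans (≤-reflexive (sym (tops-replicate [] n zero))) (tops≤bins (history start) zero)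

  extend : ∀ {p x} (P : Position p) M → Strategy p M x → Position x
  extend P M strategy = record
    { history = history P ++ M
    ; offline = offline P then strategy
    ; needs-n = λ { k k<n (σ , v) → needs-n P k k<n (prefix-valid noBins (history P) M σ v) }
    }

  flood : ∀ {p} (P : Position p) M x → Strategy p (M ++ replicate n x) x →
          Σ (Position x) λ P′ → tops (history P ++ M) x + n ≤ tops (history P′) x
                              × bins (history P ++ M) ≤ bins (history P′)
  flood P M x strategy = extend P (M ++ replicate n x) strategy , grows , more-bins
    where
    reassoc : history P ++ (M ++ replicate n x) ≡ (history P ++ M) ++ replicate n x
    reassoc = sym (++-assoc (history P) M (replicate n x))
    grows : tops (history P ++ M) x + n ≤ tops (history P ++ (M ++ replicate n x)) x
    grows = ≤-reflexive (sym (trans (cong (λ H → tops H x) reassoc) (tops-replicate (history P ++ M) n x)))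
    more-bins : bins (history P ++ M) ≤ bins (history P ++ (M ++ replicate n x))
    more-bins = subst (λ H → bins (history P ++ M) ≤ bins H) (sym reassoc) (bins-mono (history P ++ M) (replicate n x))

  Goal : Set
  Goal = ∃ λ (L : List Color) → OPTis L n × ⌈ 3 * n /2⌉ ≤ ALG A L

  finish : ∀ {p} (P : Position p) t → 3 * n ≤ t + t → t ≤ bins (history P) → Goal
  finish P t 3n≤2t t≤bins = history P , (packing-valid (offline P) , needs-n P) , (begin
    ⌈ 3 * n /2⌉  ≤⟨ ⌈n/2⌉-mono 3n≤2t ⟩
    ⌈ t + t /2⌉  ≡⟨ n≡⌈n+n/2⌉ t ⟨
    t            ≤⟨ t≤bins ⟩
    bins (history P) ∎)
    where open ≤-Reasoning

  Result : ℕ → Set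
  Result τ = ∃ λ x → Σ (Position x) λ P → τ + n ≤ tops (history P) x

  -- A round with threshold τ, allowed when 3τ ≤ ALG + 1: the input alternates
  -- col 0, col 1, … (the two colors other than p), checking after each item
  -- whether τ online bins are topped by the next color of the alternation.
  module Round {p} (P : Position p) (τ : ℕ) (room : 3 * τ ≤ suc (bins (history P))) where

    col : ℕ → Color
    col zero = next p
    col (suc zero) = prev p
    col (suc (suc i)) = col i

    col-allThree : ∀ i → AllThree p (col i) (col (suc i))
    col-allThree zero = forward p
    col-allThree (suc zero) = backward p
    col-allThree (suc (suc i)) = col-allThree i

    alt : ℕ → List Color
    alt = applyUpTo col

    after : ℕ → List Color
    after k = history P ++ alt k

    after-suc : ∀ k → after (suc k) ≡ after k ++ col k ∷ []
    after-suc k = trans (cong (history P ++_) (sym (applyUpTo-∷ʳ col k)))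
                        (sym (++-assoc (history P) (alt k) (col k ∷ [])))

    top-alt : ∀ k → top p (alt (suc k)) ≡ col k
    top-alt k = trans (cong (top p) (sym (applyUpTo-∷ʳ col k))) (top-snoc p (alt k) (col k))

    -- success after k+1 items: stack them on bin 0 offline and flood with col (k+1)
    stop : ∀ k → τ ≤ tops (after (suc k)) (col (suc k)) → Result τ
    stop k enough with flood P (alt (suc k)) (col (suc k)) strategy
      where
      linked : Linked _≢_ (p ∷ alt (suc k))
      linked = linked-applyUpTo col (suc k) (second≢third ∘ col-allThree) (first≢second (col-allThree 0))
      top≢next : top p (alt (suc k)) ≢ col (suc k)
      top≢next = subst (_≢ col (suc k)) (sym (top-alt k)) (second≢third (col-allThree k))
      strategy : Strategy p (alt (suc k) ++ replicate n (col (suc k))) (col (suc k))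
      strategy = stack-then-fill (alt (suc k)) 0<n linked top≢next (first≢second (col-allThree (suc k)))
    ... | P′ , grows , _ = col (suc k) , P′ , ≤-trans (+-monoˡ-≤ n enough) grows

    -- after n items: spread them over all bins offline and flood with p
    stop-p : τ ≤ tops (after n) p → Result τ
    stop-p enough with flood P (alt n) p strategy
      where
      strategy : Strategy p (alt n ++ replicate n p) p
      strategy = spread-then-fill (alt n) (length-applyUpTo col n)
                   (applyUpTo⁺₂ col n (λ i → ≢-sym (first≢second (col-allThree i))))
    ... | P′ , grows , _ = p , P′ , ≤-trans (+-monoˡ-≤ n enough) grows

    squeeze : ∀ k → tops (after (suc k)) (col (suc k)) < τ →
              tops (after (suc (suc k))) (col (suc (suc k))) < τ → tops (after (suc (suc k))) p < τ → ⊥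
    squeeze k small₁ small₂ small-p =
      three-below small-p last-placed small₂ (≤-trans room (s≤s (bins-mono (history P) (alt (suc (suc k))))))
                  (tops-allThree (col-allThree (suc k)) (after (suc (suc k))))
      where
      last-placed : tops (after (suc (suc k))) (col (suc k)) ≤ τ
      last-placed = begin
        tops (after (suc (suc k))) (col (suc k))
          ≡⟨ cong (λ H → tops H (col (suc k))) (after-suc (suc k)) ⟩
        tops (after (suc k) ++ col (suc k) ∷ []) (col (suc k))
          ≤⟨ tops-bound (after (suc k)) (col (suc k) ∷ []) (col (suc k)) ⟩
        tops (after (suc k)) (col (suc k)) + (ends (just (col (suc k))) (col (suc k)) + 0)
          ≡⟨ cong (λ e → tops (after (suc k)) (col (suc k)) + (e + 0)) (ends-same (col (suc k))) ⟩
        tops (after (suc k)) (col (suc k)) + 1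
          ≡⟨ +-comm _ 1 ⟩
        suc (tops (after (suc k)) (col (suc k)))
          ≤⟨ small₁ ⟩
        τ ∎
        where open ≤-Reasoning

    round : Result τ
    round with anyUpTo? (λ k → τ ≤? tops (after (suc k)) (col (suc k))) n
    ... | yes (k , _ , enough) = stop k enough
    ... | no none with τ ≤? tops (after n) p
    ...   | yes enough = stop-p enough
    ...   | no small-p with m≤n⇒∃[o]m+o≡n 1<n
    ...     | k , 2+k≡n = ⊥-elim (squeeze k (small k (≤-trans (n≤1+n _) (≤-reflexive 2+k≡n)))
                                    (small (suc k) (≤-reflexive 2+k≡n))
                                    (≰⇒> (small-p ∘ subst (λ j → τ ≤ tops (after j) p) 2+k≡n)))
      where
      small : ∀ k → k < n → tops (after (suc k)) (col (suc k)) < τ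
      small k k<n = ≰⇒> (λ enough → none (k , k<n , enough))

  round : ∀ {p} (P : Position p) τ → 3 * τ ≤ suc (bins (history P)) → Result τ
  round = Round.round

  Level : ℕ → Set
  Level E = ∃ λ p → Σ (Position p) λ P → n + E ≤ bins (history P)

  level : ∀ E → E + E ≤ n → Level E
  level zero _ = zero , start , subst (_≤ bins (history start)) (sym (+-identityʳ n)) start-bins
  level (suc E) small = climb (level E (≤-trans (+-mono-≤ (n≤1+n E) (n≤1+n E)) small))
    where
    raise : Result (suc E) → Level (suc E)
    raise (x , P , enough) = x , P , ≤-trans (≤-reflexive (+-comm n (suc E)))
                                              (≤-trans enough (tops≤bins (history P) x))
    climb : Level E → Level (suc E)
    climb (p , P , grown) = raise (round P (suc E) (room-for-round small grown))

  -- The odd case n = 2m + 1 after a round with threshold m: all n + m online bins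
  -- are topped by p.  The gadget q r p (s o)^m, where o tops the bin A uses for p,
  -- forces one more bin: either A opens a bin for p, or afterwards p or s tops
  -- more than m bins and flooding with it yields n + m + 1 bins.
  module Tight {p} (P : Position p) (m′ : ℕ) (odd : n ≡ suc (suc m′ + suc m′))
               (filled : n + suc m′ ≤ tops (history P) p) (few : bins (history P) ≤ n + suc m′) where

    m : ℕ
    m = suc m′

    size : bins (history P) ≡ n + m
    size = ≤-antisym few (≤-trans filled (tops≤bins (history P) p))

    full : tops (history P) p ≡ bins (history P)
    full = ≤-antisym (tops≤bins (history P) p) (≤-trans few filled)

    q r : Color
    q = next p
    r = prev p

    H₀ H₂ H₃ : List Color
    H₀ = history P
    H₂ = H₀ ++ q ∷ r ∷ []
    H₃ = H₀ ++ q ∷ r ∷ p ∷ []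

    gadget : Color → Color → List Color
    gadget s o = q ∷ r ∷ p ∷ pairs s o m

    H₃≡ : H₃ ≡ H₂ ++ p ∷ []
    H₃≡ = sym (++-assoc H₀ (q ∷ r ∷ []) (p ∷ []))

    after-gadget : ∀ s o → H₀ ++ gadget s o ≡ H₃ ++ pairs s o m
    after-gadget s o = sym (++-assoc H₀ (q ∷ r ∷ p ∷ []) (pairs s o m))

    Success : Set
    Success = ∃ λ y → Σ (Position y) λ P′ → suc (n + m) ≤ bins (history P′)

    -- offline: stack the gadget on bin 0 (it ends with o), then flood with s
    flood-s : ∀ {s o} → AllThree p s o → Strategy p (gadget s o ++ replicate n s) s
    flood-s {s} {o} t = stack-then-fill (gadget s o) 0<n linked top≢s (first≢second t)
      where
      linked : Linked _≢_ (p ∷ gadget s o)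
      linked = p≢next p ∷ next≢prev p ∷ ≢-sym (p≢prev p) ∷ first≢second t ∷ second≢third t
               ∷ pairs-linked (second≢third t) m′
      top≢s : top p (gadget s o) ≢ s
      top≢s = subst (_≢ s) (sym (top-pairs (second≢third t) m′)) (≢-sym (second≢third t))

    -- offline: q on bin 0, r p s on bin 1, the remaining o (s o)^(m-1) on
    -- bins 2 … n-1, then flood with p
    flood-p : ∀ {s o} → AllThree p s o → Strategy p (gadget s o ++ replicate n p) p
    flood-p {s} {o} t {l} all-p =
      place 0 0<n (λ e → p≢next p (just-injective (trans (sym (all-p 0 0<n)) e)))
        (stack 1 1<n p (r ∷ p ∷ s ∷ []) (put l 0 q) (p≢prev p ∷ ≢-sym (p≢prev p) ∷ first≢second t ∷ [-])
                 (trans (put-other l 0 q (λ ())) (all-p 1 1<n))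
         then λ { {l′} (at1 , others) →
           spread (_≢ p) 2 (o ∷ pairs s o m′) l′ fits fresh (below at1 others) (free others)
           then λ {l″} ends → fill p l″ (avoids ends) })
      where
      fresh : All (_≢ p) (o ∷ pairs s o m′)
      fresh = ≢-sym (first≢third t) ∷ pairs-avoid (≢-sym (first≢second t)) (≢-sym (first≢third t)) m′
      fits : 2 + length (o ∷ pairs s o m′) ≡ n
      fits = trans (cong (λ k → 3 + k) (length-pairs (second≢third t) m′))
                   (trans (cong (2 +_) (sym (+-suc m′ m′))) (sym odd))
      below : ∀ {l′ : LastColors} → l′ 1 ≡ just s → (∀ j → j ≢ 1 → l′ j ≡ put l 0 q j) →
              ∀ j → j < 2 → ∃ λ c → l′ j ≡ just c × c ≢ p
      below at1 others zero _ = q , trans (others 0 (λ ())) (put-same l 0 q) , ≢-sym (p≢next p)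
      below at1 others (suc zero) _ = s , at1 , ≢-sym (first≢second t)
      below at1 others (suc (suc j)) (s≤s (s≤s ()))
      free : ∀ {l′ : LastColors} → (∀ j → j ≢ 1 → l′ j ≡ put l 0 q j) →
             ∀ j c → 2 ≤ j → j < n → c ≢ p → l′ j ≢ just c
      free {l′} others j c 2≤j j<n c≢p e = c≢p (just-injective (begin
        just c         ≡⟨ e ⟨
        l′ j           ≡⟨ others j (λ { refl → 1+n≰n 2≤j }) ⟩
        put l 0 q j    ≡⟨ put-other l 0 q (λ { refl → 1+n≰n (≤-trans (n≤1+n 1) 2≤j) }) ⟩
        l j            ≡⟨ all-p j j<n ⟩
        just p         ∎))
        where open ≡-Reasoning

    Hf : Color → Color → List Color
    Hf s o = H₀ ++ gadget s o

    success-with : ∀ {s o} y → Strategy p (gadget s o ++ replicate n y) y → suc m ≤ tops (Hf s o) y → Success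
    success-with {s} {o} y strategy enough with flood P (gadget s o) y strategy
    ... | P′ , grows , _ = y , P′ , (begin
      suc (n + m)              ≡⟨ cong suc (+-comm n m) ⟩
      suc m + n                ≤⟨ +-monoˡ-≤ n enough ⟩
      tops (Hf s o) y + n      ≤⟨ grows ⟩
      tops (history P′) y      ≤⟨ tops≤bins (history P′) y ⟩
      bins (history P′)        ∎)
      where open ≤-Reasoning

    chosen-p : ℕ
    chosen-p = chosen (state H₂) p

    new-bin : chosen-p ≡ bins H₂ → Success
    new-bin b≡N with flood P (gadget q r) q (flood-s (forward p))
    ... | P′ , _ , more = q , P′ , (begin
      suc (n + m)                  ≡⟨ cong suc size ⟨
      suc (bins H₀)                ≤⟨ s≤s (bins-mono H₀ (q ∷ r ∷ [])) ⟩
      suc (bins H₂)                ≡⟨ bins-new H₂ p b≡N ⟨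
      bins (H₂ ++ p ∷ [])          ≡⟨ cong bins H₃≡ ⟨
      bins H₃                      ≤⟨ bins-mono H₃ (pairs q r m) ⟩
      bins (H₃ ++ pairs q r m)     ≡⟨ cong bins (after-gadget q r) ⟨
      bins (Hf q r)                ≤⟨ more ⟩
      bins (history P′)            ∎)
      where open ≤-Reasoning

    -- if A puts p on an old bin topped by o, the bins topped by o disappear
    module OldBin {s o} (t : AllThree p s o) (b<N : chosen-p < bins H₂)
                  (top≡o : lastc (state H₂) chosen-p ≡ just o) where

      no-o₀ : tops H₀ o ≡ 0
      no-o₀ = last-zero (trans (tops-allThree t H₀) (sym full))

      one-o₂ : tops H₂ o ≤ 1
      one-o₂ = begin
        tops H₂ o                                         ≤⟨ tops-bound H₀ (q ∷ r ∷ []) o ⟩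
        tops H₀ o + occurrences o (q ∷ r ∷ [])            ≡⟨ cong₂ _+_ no-o₀ (occurrences-others t) ⟩
        1                                                 ∎
        where open ≤-Reasoning

      no-o₃ : tops H₃ o ≡ 0
      no-o₃ = n≤0⇒n≡0 (s≤s⁻¹ (begin
        suc (tops H₃ o)               ≡⟨ cong (λ H → suc (tops H o)) H₃≡ ⟩
        suc (tops (H₂ ++ p ∷ []) o)   ≡⟨ tops-cover H₂ p o b<N top≡o (≢-sym (first≢third t)) ⟩
        tops H₂ o                     ≤⟨ one-o₂ ⟩
        1                             ∎))
        where open ≤-Reasoning

      few-o : tops (Hf s o) o ≤ m
      few-o = begin
        tops (Hf s o) o                                 ≡⟨ cong (λ H → tops H o) (after-gadget s o) ⟩
        tops (H₃ ++ pairs s o m) o                      ≤⟨ tops-bound H₃ (pairs s o m) o ⟩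
        tops H₃ o + occurrences o (pairs s o m)
          ≡⟨ cong₂ _+_ no-o₃ (occurrences-pairs (second≢third t) m) ⟩
        m                                               ∎
        where open ≤-Reasoning

      many-bins : suc (m + m) + m ≤ bins (Hf s o)
      many-bins = begin
        suc (m + m) + m   ≡⟨ cong (_+ m) odd ⟨
        n + m             ≡⟨ size ⟨
        bins H₀           ≤⟨ bins-mono H₀ (gadget s o) ⟩
        bins (Hf s o)     ∎
        where open ≤-Reasoning

      success : Success
      success with suc m ≤? tops (Hf s o) p
      ... | yes enough-p = success-with p (flood-p t) enough-p
      ... | no small-p = success-with s (flood-s t)
              (middle-large (tops-allThree t (Hf s o)) (s≤s⁻¹ (≰⇒> small-p)) few-o many-bins)

    success : Success
    success with proj₁ (legal-after H₂ (p ∷ []))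
    ... | inj₂ b≡N = new-bin b≡N
    ... | inj₁ (b<N , free) with lastc (state H₂) chosen-p in top≡
    ...   | nothing = ⊥-elim (nonempty H₂ chosen-p b<N top≡)
    ...   | just d with completeTriple {p} {d} (free ∘ cong just)
    ...     | s , t = OldBin.success t b<N top≡

  finish-or : ∀ {p} (P : Position p) t → 3 * n ≤ t + t → (bins (history P) < t → Goal) → Goal
  finish-or P t target continue with t ≤? bins (history P)
  ... | yes enough = finish P t target enough
  ... | no few = continue (≰⇒> few)

  when-even : ∀ h → n ≡ h + h → Goal
  when-even h even with level h (≤-reflexive (sym even))
  ... | p , P , grown = finish P (n + h) (even-target h even) grown

  when-odd : ∀ m′ → n ≡ suc (suc m′ + suc m′) → Goal
  when-odd m′ odd = after-levels (level m (≤-trans (n≤1+n _) (≤-reflexive (sym odd))))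
    where
    m : ℕ
    m = suc m′
    target : 3 * n ≤ suc (n + m) + suc (n + m)
    target = odd-target m odd
    after-round : Result m → Goal
    after-round (x , P , filled) = finish-or P (suc (n + m)) target λ few →
      let (y , P′ , enough) = Tight.success P m′ odd (subst (_≤ tops (history P) x) (+-comm m n) filled)
                                                     (s≤s⁻¹ few)
      in finish P′ _ target enough
    after-levels : Level m → Goal
    after-levels (p , P , grown) = finish-or P (suc (n + m)) target λ _ →
      after-round (round P m (≤-trans (odd-room m odd) (s≤s grown)))

theorem3p1 : (A : OnlineAlg) → ValidAlg A → (n : ℕ) → 1 < n →
    ∃ λ (L : List Color) → OPTis L n × ⌈ 3 * n /2⌉ ≤ ALG A L
theorem3p1 A valid n 1<n with parity n
... | h , inj₁ even = Adversary.when-even A valid n 1<n h even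
... | zero , inj₂ odd = ⊥-elim (<-irrefl (sym odd) 1<n)
... | suc m′ , inj₂ odd = Adversary.when-odd A valid n 1<n m′ odd
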